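{- Let $G =(V,W,E)$ be a bipartite graph and $I\subseteq W$. If $R^{I}(G)$ is rigid, then for every equitable coloring $\chi$ of $R^I(G)$, every color-component of $(V(R(G)),E(R(G)),\chi)$ is a union of color classes of $\chi$.
   Context: Multipede construction $R(G)$: for each $w\in W$ vertices $a(w),b(w)$, $F(w)=\{a(w),b(w)\}$; for each $v\in V$ and $A\subseteq N(v)$ with $|A|$ even a vertex $m_A(v)$, $M(v)$ the set of these; edges $\{a(w),m_A(v)\}$ for $w\in A$ and $\{b(w),m_A(v)\}$ for $w\in N(v)\setminus A$. $R(G)$ is colored with color classes exactly the $F(w)$ and $M(v)$; $R^I(G)$ refines this coloring so that $\{a(w)\},\{b(w)\}$ are color classes for $w\in I$. Rigid: only the identity is a color-preserving automorphism. A coloring $\chi$ is an equitable coloring of $R^I(G)$ if $\chi$ refines the coloring $c_I$ of $R^I(G)$ ($\chi(x)=\chi(y)\Rightarrow c_I(x)=c_I(y)$) and for all colors $i,j$ and all $x,y\in\chi^{ -1}(i)$, $|N(x)\cap\chi^{ -1}(j)|=|N(y)\cap\chi^{ -1}(j)|$. Disjoint sets $X,Y$ are uniformly joined if no or all pairs in $X\times Y$ are edges. For a colored graph with coloring $\chi$, $S$ is a color-component if for all colors $i,j$ the sets $S\cap\chi^{ -1}(i)$ and $\chi^{ -1}(j)\setminus S$ are uniformly joined. -}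

module Defs where

open import Data.Nat using (ℕ; zero; suc; _+_; _≡ᵇ_)
open import Data.Bool using (Bool; true; false; _∧_; _∨_; not; if_then_else_; T)
open import Data.Unit using (tt)
open import Data.Fin using (Fin)
open import Data.Vec using (Vec; []; _∷_; lookup; tabulate)
open import Data.List using (List; []; _∷_; _++_; concatMap; map; allFin)
open import Data.Sum using (_⊎_)
open import Data.Product using (_×_)
open import Data.Empty using (⊥)
open import Relation.Binary.PropositionalEquality using (_≡_)
open import Function.Definitions using (Bijective)

-- A finite bipartite graph G = (V, W, E) with V = Fin n, W = Fin m and
-- E given by a Boolean adjacency predicate E v w (v ∈ V, w ∈ W).
-- Subsets of W are Boolean vectors (Vec Bool m).

Nbh : ∀ {n m} → (Fin n → Fin m → Bool) → Fin n → Vec Bool m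
Nbh E v = tabulate (E v)

_⊆ᵇ_ : ∀ {m} → Vec Bool m → Vec Bool m → Bool
[] ⊆ᵇ [] = true
(x ∷ xs) ⊆ᵇ (y ∷ ys) = (not x ∨ y) ∧ (xs ⊆ᵇ ys)

card : ∀ {m} → Vec Bool m → ℕ
card [] = 0
card (true ∷ xs) = suc (card xs)
card (false ∷ xs) = card xs

evenᵇ : ℕ → Bool
evenᵇ zero = true
evenᵇ (suc k) = not (evenᵇ k)

good : ∀ {n m} → (Fin n → Fin m → Bool) → Fin n → Vec Bool m → Bool
good E v A = (A ⊆ᵇ Nbh E v) ∧ evenᵇ (card A)

data Vtx {n m : ℕ} (E : Fin n → Fin m → Bool) : Set where
  a  : Fin m → Vtx E
  b  : Fin m → Vtx E
  mv : (v : Fin n) (A : Vec Bool m) → .(T (good E v A)) → Vtx E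

adjR : ∀ {n m} {E : Fin n → Fin m → Bool} → Vtx E → Vtx E → Bool
adjR {E = E} (a w) (mv v A _) = lookup A w
adjR {E = E} (b w) (mv v A _) = E v w ∧ not (lookup A w)
adjR {E = E} (mv v A _) (a w) = lookup A w
adjR {E = E} (mv v A _) (b w) = E v w ∧ not (lookup A w)
adjR _ _ = false

-- Colours of R^I(G): F(w), M(v), and for w ∈ I the singletons {a(w)}, {b(w)}
data Col (n m : ℕ) : Set where
  colF : Fin m → Col n m
  colM : Fin n → Col n m
  colA : Fin m → Col n m
  colB : Fin m → Col n m

cI : ∀ {n m} {E : Fin n → Fin m → Bool} → (Fin m → Bool) → Vtx E → Col n m
cI I (a w) = if I w then colA w else colF w
cI I (b w) = if I w then colB w else colF w
cI I (mv v A _) = colM v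

Rigid : ∀ {n m} (E : Fin n → Fin m → Bool) → (Fin m → Bool) → Set
Rigid E I =
  (f : Vtx E → Vtx E) → Bijective _≡_ _≡_ f →
  (∀ x y → adjR (f x) (f y) ≡ adjR x y) →
  (∀ x → cI I (f x) ≡ cI I x) →
  ∀ x → f x ≡ x

allVecs : (m : ℕ) → List (Vec Bool m)
allVecs zero = [] ∷ []
allVecs (suc m) = map (true ∷_) (allVecs m) ++ map (false ∷_) (allVecs m)

ifT : {X : Set} (c : Bool) → (T c → X) → List X
ifT true f = f tt ∷ []
ifT false f = []

allVtx : ∀ {n m} (E : Fin n → Fin m → Bool) → List (Vtx E)
allVtx {n} {m} E =
  map a (allFin m) ++ map b (allFin m) ++
  concatMap (λ v → concatMap (λ A → ifT (good E v A) (λ p → mv v A p)) (allVecs m)) (allFin n)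

countᵇ : {X : Set} → (X → Bool) → List X → ℕ
countᵇ p [] = 0
countᵇ p (x ∷ xs) = if p x then suc (countᵇ p xs) else countᵇ p xs

degTo : ∀ {n m} {E : Fin n → Fin m → Bool} → (Vtx E → ℕ) → Vtx E → ℕ → ℕ
degTo {E = E} χ x j = countᵇ (λ y → adjR x y ∧ (χ y ≡ᵇ j)) (allVtx E)

Equitable : ∀ {n m} (E : Fin n → Fin m → Bool) → (Fin m → Bool) → (Vtx E → ℕ) → Set
Equitable E I χ =
  (∀ x y → χ x ≡ χ y → cI I x ≡ cI I y) ×
  (∀ i j x y → χ x ≡ i → χ y ≡ i → degTo χ x j ≡ degTo χ y j)

UniformlyJoined : ∀ {n m} {E : Fin n → Fin m → Bool} → (Vtx E → Set) → (Vtx E → Set) → Set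
UniformlyJoined {E = E} X Y =
  (∀ x y → X x → Y y → adjR x y ≡ false) ⊎ (∀ x y → X x → Y y → adjR x y ≡ true)

ColorComponent : ∀ {n m} (E : Fin n → Fin m → Bool) → (Vtx E → ℕ) → (Vtx E → Bool) → Set
ColorComponent E χ S =
  ∀ i j → UniformlyJoined (λ x → (S x ≡ true) × (χ x ≡ i))
                          (λ y → (χ y ≡ j) × (S y ≡ false))

UnionOfClasses : ∀ {n m} (E : Fin n → Fin m → Bool) → (Vtx E → ℕ) → (Vtx E → Bool) → Set
UnionOfClasses E χ S = ∀ x y → χ x ≡ χ y → S x ≡ true → S y ≡ true

module Submission where

-- Suppose two χ-equivalent vertices lay on different sides of S.  Call a
-- wire w "twisted" if a(w), b(w) are χ-equivalent but separated by S.
-- Flipping a set of wires T, i.e. swapping a(w) ↔ b(w) for w ∈ T and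
-- sending m_A(v) to m_{A ⊕ (T ∩ N(v))}(v), is an automorphism of R(G)
-- whenever every |T ∩ N(v)| is even, and it preserves the colouring of
-- R^I(G) when T avoids I.  The twisted wires satisfy both conditions:
-- the key observation is that for a split pair m_A(v), m_B(v) of one
-- χ-class, the twisted neighbours of v are exactly A ⊕ B, which is even.
-- Rigidity therefore leaves no twisted wire, and then a split pair of a
-- χ-class can be neither a pair of wire ends nor a pair m_A(v), m_B(v).

open import Defs
open import Data.Nat using (ℕ; zero; suc; _≡ᵇ_)
open import Data.Nat.Properties using (≡ᵇ⇒≡; ≡⇒≡ᵇ) renaming (_≟_ to _≟ℕ_)
open import Data.Bool using (Bool; true; false; _∧_; _∨_; not; _xor_; T; T?)
open import Data.Bool.Properties
  using (_≟_; not-involutive; not-injective; not-¬; ¬-not; xor-same; xor-identityʳ;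
         xor-annihilates-not; not-distribˡ-xor; not-distribʳ-xor; ∧-identityʳ; ∧-zeroʳ; T-≡)
open import Data.Fin using (Fin; zero; suc)
open import Data.Vec using (Vec; []; _∷_; lookup; tabulate; zipWith; replicate)
open import Data.Vec.Properties
  using (lookup-zipWith; lookup-replicate; lookup∘tabulate; tabulate∘lookup; tabulate-cong)
open import Data.List using ([]; _∷_; map; allFin)
open import Data.List.Membership.Propositional using (_∈_; lose)
open import Data.List.Membership.Propositional.Properties
  using (∈-map⁺; ∈-++⁺ˡ; ∈-++⁺ʳ; ∈-concatMap⁺; ∈-allFin)
open import Data.List.Relation.Unary.Any using (here; there)
open import Data.Product using (_×_; _,_; ∃; proj₁; proj₂)
open import Data.Sum using (_⊎_; inj₁; inj₂)
open import Data.Empty using (⊥; ⊥-elim)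
open import Function using (_∘_)
open import Function.Bundles using (module Equivalence)
open import Function.Consequences.Propositional
  using (strictlyInverseˡ⇒inverseˡ; strictlyInverseʳ⇒inverseʳ; inverseᵇ⇒bijective)
open import Function.Definitions using (Bijective)
open import Relation.Nullary using (¬_; Dec; yes; no; does)
open import Relation.Nullary.Decidable
  using (recompute; dec-true; ¬?; _×-dec_; decidable-stable)
open import Relation.Binary.PropositionalEquality

open Equivalence using (to; from)

bool-dichotomy : ∀ {x y} → x ≢ y → ∀ z → z ≡ x ⊎ z ≡ y
bool-dichotomy {x} {y} x≢y z with z ≟ x
... | yes z≡x = inj₁ z≡x
... | no z≢x = inj₂ (trans (¬-not z≢x) (sym (¬-not (x≢y ∘ sym))))

one-differs : ∀ {x y} → x ≢ y → ∀ z → x ≢ z ⊎ y ≢ z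
one-differs x≢y z with bool-dichotomy x≢y z
... | inj₁ refl = inj₂ (x≢y ∘ sym)
... | inj₂ refl = inj₁ x≢y

true≢false : true ≢ false
true≢false ()

∧-elim : ∀ {x y} → x ∧ y ≡ true → x ≡ true × y ≡ true
∧-elim {true} {true} _ = refl , refl

xor-≢ : ∀ {x y} → x ≢ y → x xor y ≡ true
xor-≢ {false} {false} x≢y = ⊥-elim (x≢y refl)
xor-≢ {false} {true} _ = refl
xor-≢ {true} {false} _ = refl
xor-≢ {true} {true} x≢y = ⊥-elim (x≢y refl)

xor-≡ : ∀ {x y} → x ≡ y → x xor y ≡ false
xor-≡ {x} refl = xor-same x

xor-cancelʳ : ∀ x y t → (x xor t) xor (y xor t) ≡ x xor y
xor-cancelʳ false false false = refl
xor-cancelʳ false false true = refl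
xor-cancelʳ false true false = refl
xor-cancelʳ false true true = refl
xor-cancelʳ true false false = refl
xor-cancelʳ true false true = refl
xor-cancelʳ true true false = refl
xor-cancelʳ true true true = refl

xor-twice : ∀ x t → (x xor t) xor t ≡ x
xor-twice x t = trans (xor-cancelʳ x false t) (xor-identityʳ x)

vec-ext : ∀ {X : Set} {k} {A B : Vec X k} → (∀ i → lookup A i ≡ lookup B i) → A ≡ B
vec-ext {A = A} {B} same =
  trans (sym (tabulate∘lookup A)) (trans (tabulate-cong same) (tabulate∘lookup B))

⊆ᵇ-sound : ∀ {k} (A B : Vec Bool k) → A ⊆ᵇ B ≡ true →
           ∀ i → lookup B i ≡ false → lookup A i ≡ false
⊆ᵇ-sound (false ∷ A) (y ∷ B) A⊆B zero _ = refl
⊆ᵇ-sound (true ∷ A) (false ∷ B) () zero _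
⊆ᵇ-sound (true ∷ A) (true ∷ B) A⊆B zero ()
⊆ᵇ-sound (x ∷ A) (y ∷ B) A⊆B (suc i) = ⊆ᵇ-sound A B (proj₂ (∧-elim {not x ∨ y} A⊆B)) i

⊆ᵇ-complete : ∀ {k} (A B : Vec Bool k) →
              (∀ i → lookup B i ≡ false → lookup A i ≡ false) → A ⊆ᵇ B ≡ true
⊆ᵇ-complete [] [] _ = refl
⊆ᵇ-complete (false ∷ A) (y ∷ B) A⊆B = ⊆ᵇ-complete A B (A⊆B ∘ suc)
⊆ᵇ-complete (true ∷ A) (true ∷ B) A⊆B = ⊆ᵇ-complete A B (A⊆B ∘ suc)
⊆ᵇ-complete (true ∷ A) (false ∷ B) A⊆B with A⊆B zero refl
... | ()

card-empty : ∀ k → card (replicate k false) ≡ 0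
card-empty zero = refl
card-empty (suc k) = card-empty k

empty-or-member : ∀ {k} (A : Vec Bool k) → A ≡ replicate k false ⊎ ∃ λ i → lookup A i ≡ true
empty-or-member [] = inj₁ refl
empty-or-member (true ∷ A) = inj₂ (zero , refl)
empty-or-member (false ∷ A) with empty-or-member A
... | inj₁ empty = inj₁ (cong (false ∷_) empty)
... | inj₂ (i , member) = inj₂ (suc i , member)

even-xor : ∀ {k} (A B : Vec Bool k) →
           evenᵇ (card (zipWith _xor_ A B)) ≡ not (evenᵇ (card A) xor evenᵇ (card B))
even-xor [] [] = refl
even-xor (true ∷ A) (true ∷ B) =
  trans (even-xor A B) (cong not (sym (xor-annihilates-not (evenᵇ (card A)) (evenᵇ (card B)))))
even-xor (true ∷ A) (false ∷ B) =
  cong not (trans (even-xor A B) (not-distribˡ-xor (evenᵇ (card A)) (evenᵇ (card B))))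
even-xor (false ∷ A) (true ∷ B) =
  cong not (trans (even-xor A B) (not-distribʳ-xor (evenᵇ (card A)) (evenᵇ (card B))))
even-xor (false ∷ A) (false ∷ B) = even-xor A B

even-xor-closed : ∀ {k} {A B : Vec Bool k} → evenᵇ (card A) ≡ true → evenᵇ (card B) ≡ true →
                  evenᵇ (card (zipWith _xor_ A B)) ≡ true
even-xor-closed {A = A} {B} evenA evenB =
  trans (even-xor A B) (cong₂ (λ x y → not (x xor y)) evenA evenB)

count-positive : ∀ {X : Set} (P : X → Bool) {l z} → z ∈ l → P z ≡ true → countᵇ P l ≢ 0
count-positive P {x ∷ l} z∈l Pz zero-count with P x in Px
count-positive P {x ∷ l} z∈l Pz () | true
count-positive P {x ∷ l} (here refl) Pz _ | false = true≢false (trans (sym Pz) Px)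
count-positive P {x ∷ l} (there z∈l) Pz zero-count | false =
  count-positive P z∈l Pz zero-count

count-witness : ∀ {X : Set} (P : X → Bool) l → countᵇ P l ≢ 0 → ∃ λ z → P z ≡ true
count-witness P [] nonzero = ⊥-elim (nonzero refl)
count-witness P (x ∷ l) nonzero with P x in Px
... | true = x , Px
... | false = count-witness P l nonzero

count-transfer : ∀ {X : Set} {P Q : X → Bool} {l z} → z ∈ l → P z ≡ true →
                 countᵇ P l ≡ countᵇ Q l → ∃ λ z' → Q z' ≡ true
count-transfer {P = P} {Q} {l} z∈l Pz same =
  count-witness Q l (count-positive P z∈l Pz ∘ trans same)

module Multipede {n m : ℕ} (E : Fin n → Fin m → Bool) where

  index-good : ∀ {v A} → .(T (good E v A)) → (A ⊆ᵇ Nbh E v ≡ true) × (evenᵇ (card A) ≡ true)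
  index-good {v} {A} p = ∧-elim (to T-≡ (recompute (T? (good E v A)) p))

  outside-nbh : ∀ {v A w} → .(T (good E v A)) → E v w ≡ false → lookup A w ≡ false
  outside-nbh {v} {A} {w} p w∉N =
    ⊆ᵇ-sound A (Nbh E v) (proj₁ (index-good {v} {A} p)) w (trans (lookup∘tabulate (E v) w) w∉N)

  index-intro : ∀ {v A} → (∀ w → E v w ≡ false → lookup A w ≡ false) →
                evenᵇ (card A) ≡ true → T (good E v A)
  index-intro {v} {A} within evenA = from T-≡ (cong₂ _∧_ A⊆N evenA)
    where
    A⊆N : A ⊆ᵇ Nbh E v ≡ true
    A⊆N = ⊆ᵇ-complete A (Nbh E v) (λ w w∉N → within w (trans (sym (lookup∘tabulate (E v) w)) w∉N))

  empty-index : ∀ {v} → T (good E v (replicate m false))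
  empty-index {v} =
    index-intro {v} {replicate m false} (λ w _ → lookup-replicate w false) (cong evenᵇ (card-empty m))

  mv-cong : ∀ {v A B} .{p : T (good E v A)} .{q : T (good E v B)} → A ≡ B → mv {E = E} v A p ≡ mv v B q
  mv-cong refl = refl

  adj-sym : ∀ x y → adjR {E = E} x y ≡ adjR y x
  adj-sym (a w) (a w') = refl
  adj-sym (a w) (b w') = refl
  adj-sym (a w) (mv v A p) = refl
  adj-sym (b w) (a w') = refl
  adj-sym (b w) (b w') = refl
  adj-sym (b w) (mv v A p) = refl
  adj-sym (mv v A p) (a w) = refl
  adj-sym (mv v A p) (b w) = refl
  adj-sym (mv v A p) (mv v' A' p') = refl

  allVtx-complete : ∀ z → z ∈ allVtx E
  allVtx-complete (a w) = ∈-++⁺ˡ (∈-map⁺ a (∈-allFin w))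
  allVtx-complete (b w) = ∈-++⁺ʳ (map a (allFin m)) (∈-++⁺ˡ (∈-map⁺ b (∈-allFin w)))
  allVtx-complete (mv v A p) =
    ∈-++⁺ʳ (map a (allFin m)) (∈-++⁺ʳ (map b (allFin m))
      (∈-concatMap⁺ _ (lose (∈-allFin v)
        (∈-concatMap⁺ _ (lose (allVecs-complete A)
          (ifT-complete (good E v A) (λ t → mv {E = E} v A t) (recompute (T? (good E v A)) p)))))))
    where
    allVecs-complete : ∀ {k} (B : Vec Bool k) → B ∈ allVecs k
    allVecs-complete [] = here refl
    allVecs-complete (true ∷ B) = ∈-++⁺ˡ (∈-map⁺ (true ∷_) (allVecs-complete B))
    allVecs-complete {suc k} (false ∷ B) =
      ∈-++⁺ʳ (map (true ∷_) (allVecs k)) (∈-map⁺ (false ∷_) (allVecs-complete B))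

    ifT-complete : ∀ {X : Set} c (f : T c → X) (t : T c) → f t ∈ ifT c f
    ifT-complete true f t = here refl

  end : Bool → Fin m → Vtx E
  end true w = a w
  end false w = b w

  end-injective : ∀ {e e' w} → end e w ≡ end e' w → e ≡ e'
  end-injective {true} {true} _ = refl
  end-injective {false} {false} _ = refl
  end-injective {true} {false} ()
  end-injective {false} {true} ()

  ends-nonadjacent : ∀ e e' w w' → adjR (end e w) (end e' w') ≡ false
  ends-nonadjacent true true w w' = refl
  ends-nonadjacent true false w w' = refl
  ends-nonadjacent false true w w' = refl
  ends-nonadjacent false false w w' = refl

  adj-end : ∀ e w {v A} .(p : T (good E v A)) →
            adjR (end e w) (mv v A p) ≡ E v w ∧ not (e xor lookup A w)
  adj-end false w p = refl
  adj-end true w {v} {A} p with E v w in w∈N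
  ... | true = sym (not-involutive (lookup A w))
  ... | false = outside-nbh {v} {A} p w∈N

  part : Vtx E → Fin m ⊎ Fin n
  part (a w) = inj₁ w
  part (b w) = inj₁ w
  part (mv v A p) = inj₂ v

  colour-part : Col n m → Fin m ⊎ Fin n
  colour-part (colF w) = inj₁ w
  colour-part (colA w) = inj₁ w
  colour-part (colB w) = inj₁ w
  colour-part (colM v) = inj₂ v

  part-cI : ∀ I x → colour-part (cI I x) ≡ part x
  part-cI I (a w) with I w
  ... | true = refl
  ... | false = refl
  part-cI I (b w) with I w
  ... | true = refl
  ... | false = refl
  part-cI I (mv v A p) = refl

  wire-view : ∀ {z w} → part z ≡ inj₁ w → z ≡ a w ⊎ z ≡ b w
  wire-view {a w} refl = inj₁ refl
  wire-view {b w} refl = inj₂ refl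

  data InM (v : Fin n) : Vtx E → Set where
    m-vertex : ∀ A .(p : T (good E v A)) → InM v (mv v A p)

  M-view : ∀ {z v} → part z ≡ inj₂ v → InM v z
  M-view {mv v A p} refl = m-vertex A p

  ends-complementary : ∀ {v w z} → E v w ≡ true → InM v z → adjR (b w) z ≡ not (adjR (a w) z)
  ends-complementary {w = w} w∈N (m-vertex A p) = cong (_∧ not (lookup A w)) w∈N

  end-colours-agree : ∀ {I w} e e' → I w ≡ false → cI I (end e w) ≡ cI I (end e' w)
  end-colours-agree {I} {w} e e' w∉I = trans (wire-colour e) (sym (wire-colour e'))
    where
    wire-colour : ∀ e → cI I (end e w) ≡ colF w
    wire-colour true rewrite w∉I = refl
    wire-colour false rewrite w∉I = refl

  equal-end-colours : ∀ {I w} → cI I (a {E = E} w) ≡ cI I (b {E = E} w) → I w ≡ false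
  equal-end-colours {I} {w} same with I w | same
  ... | true | ()
  ... | false | _ = refl

  joined-constant : ∀ {X Y : Vtx E → Set} → UniformlyJoined X Y →
                    ∀ {x x' y y'} → X x → X x' → Y y → Y y' → adjR x y ≡ adjR x' y'
  joined-constant (inj₁ none) Xx Xx' Yy Yy' = trans (none _ _ Xx Yy) (sym (none _ _ Xx' Yy'))
  joined-constant (inj₂ all) Xx Xx' Yy Yy' = trans (all _ _ Xx Yy) (sym (all _ _ Xx' Yy'))

  wiresAt : (Fin m → Bool) → Fin n → Vec Bool m
  wiresAt W v = tabulate (λ w → W w ∧ E v w)

  module Flip (flips : Fin m → Bool)
              (balanced : ∀ v → evenᵇ (card (wiresAt flips v)) ≡ true) where

    shift : Fin n → Vec Bool m → Vec Bool m
    shift v A = zipWith _xor_ A (wiresAt flips v)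

    lookup-shift : ∀ {v} A w → lookup (shift v A) w ≡ lookup A w xor (flips w ∧ E v w)
    lookup-shift {v} A w =
      trans (lookup-zipWith _xor_ w A (wiresAt flips v)) (cong (lookup A w xor_) (lookup∘tabulate _ w))

    shift-good : ∀ {v A} → .(T (good E v A)) → T (good E v (shift v A))
    shift-good {v} {A} p = index-intro {v} {shift v A} within
      (even-xor-closed {A = A} {wiresAt flips v} (proj₂ (index-good {v} {A} p)) (balanced v))
      where
      within : ∀ w → E v w ≡ false → lookup (shift v A) w ≡ false
      within w w∉N = begin
        lookup (shift v A) w                   ≡⟨ lookup-shift A w ⟩
        lookup A w xor (flips w ∧ E v w)
          ≡⟨ cong₂ (λ α ε → α xor (flips w ∧ ε)) (outside-nbh {v} {A} p w∉N) w∉N ⟩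
        flips w ∧ false                        ≡⟨ ∧-zeroʳ (flips w) ⟩
        false                                  ∎
        where open ≡-Reasoning

    flip : Vtx E → Vtx E
    flip (a w) = end (not (flips w)) w
    flip (b w) = end (flips w) w
    flip (mv v A p) = mv v (shift v A) (shift-good {v} {A} p)

    flip-end : ∀ e w → flip (end e w) ≡ end (e xor flips w) w
    flip-end true w = refl
    flip-end false w = refl

    end-involutive : ∀ e w → flip (flip (end e w)) ≡ end e w
    end-involutive e w = begin
      flip (flip (end e w))               ≡⟨ cong flip (flip-end e w) ⟩
      flip (end (e xor flips w) w)        ≡⟨ flip-end (e xor flips w) w ⟩
      end ((e xor flips w) xor flips w) w ≡⟨ cong (λ e' → end e' w) (xor-twice e (flips w)) ⟩
      end e w                             ∎
      where open ≡-Reasoning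

    flip-involutive : ∀ x → flip (flip x) ≡ x
    flip-involutive (a w) = end-involutive true w
    flip-involutive (b w) = end-involutive false w
    flip-involutive (mv v A p) = mv-cong (vec-ext shift-twice)
      where
      shift-twice : ∀ w → lookup (shift v (shift v A)) w ≡ lookup A w
      shift-twice w = begin
        lookup (shift v (shift v A)) w
          ≡⟨ lookup-shift (shift v A) w ⟩
        lookup (shift v A) w xor (flips w ∧ E v w)
          ≡⟨ cong (_xor (flips w ∧ E v w)) (lookup-shift A w) ⟩
        (lookup A w xor (flips w ∧ E v w)) xor (flips w ∧ E v w)
          ≡⟨ xor-twice (lookup A w) (flips w ∧ E v w) ⟩
        lookup A w ∎
        where open ≡-Reasoning

    flip-bijective : Bijective _≡_ _≡_ flip
    flip-bijective = inverseᵇ⇒bijective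
      ( strictlyInverseˡ⇒inverseˡ {f⁻¹ = flip} flip flip-involutive
      , strictlyInverseʳ⇒inverseʳ {f⁻¹ = flip} flip flip-involutive )

    -- Flipping w and shifting A by w (for w ∈ N(v)) cancel in the adjacency test.
    flip-invariant : ∀ ε t e α → ε ∧ not ((e xor t) xor (α xor (t ∧ ε))) ≡ ε ∧ not (e xor α)
    flip-invariant false t e α = refl
    flip-invariant true t e α =
      cong not (trans (cong (λ s → (e xor t) xor (α xor s)) (∧-identityʳ t)) (xor-cancelʳ e α t))

    flip-end-adjacent : ∀ e w {v A} .(p : T (good E v A)) →
                        adjR (flip (end e w)) (flip (mv v A p)) ≡ adjR (end e w) (mv v A p)
    flip-end-adjacent e w {v} {A} p = begin
      adjR (flip (end e w)) (flip (mv v A p))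
        ≡⟨ cong (λ x → adjR x (flip (mv v A p))) (flip-end e w) ⟩
      adjR (end (e xor flips w) w) (flip (mv v A p))
        ≡⟨ adj-end (e xor flips w) w (shift-good {v} {A} p) ⟩
      E v w ∧ not ((e xor flips w) xor lookup (shift v A) w)
        ≡⟨ cong (λ s → E v w ∧ not ((e xor flips w) xor s)) (lookup-shift A w) ⟩
      E v w ∧ not ((e xor flips w) xor (lookup A w xor (flips w ∧ E v w)))
        ≡⟨ flip-invariant (E v w) (flips w) e (lookup A w) ⟩
      E v w ∧ not (e xor lookup A w)
        ≡⟨ sym (adj-end e w p) ⟩
      adjR (end e w) (mv v A p) ∎
      where open ≡-Reasoning

    flip-adjacent : ∀ x y → adjR (flip x) (flip y) ≡ adjR x y
    flip-adjacent (a w) (a w') = ends-nonadjacent (not (flips w)) (not (flips w')) w w'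
    flip-adjacent (a w) (b w') = ends-nonadjacent (not (flips w)) (flips w') w w'
    flip-adjacent (b w) (a w') = ends-nonadjacent (flips w) (not (flips w')) w w'
    flip-adjacent (b w) (b w') = ends-nonadjacent (flips w) (flips w') w w'
    flip-adjacent (a w) (mv v A p) = flip-end-adjacent true w p
    flip-adjacent (b w) (mv v A p) = flip-end-adjacent false w p
    flip-adjacent (mv v A p) (a w) =
      trans (adj-sym (flip (mv v A p)) (flip (a w))) (flip-end-adjacent true w p)
    flip-adjacent (mv v A p) (b w) =
      trans (adj-sym (flip (mv v A p)) (flip (b w))) (flip-end-adjacent false w p)
    flip-adjacent (mv v A p) (mv v' A' p') = refl

    flip-colour : ∀ I → (∀ w → flips w ≡ true → I w ≡ false) → ∀ x → cI I (flip x) ≡ cI I x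
    flip-colour I avoids (a w) with flips w in flipped
    ... | true = end-colours-agree {I} false true (avoids w flipped)
    ... | false = refl
    flip-colour I avoids (b w) with flips w in flipped
    ... | true = end-colours-agree {I} true false (avoids w flipped)
    ... | false = refl
    flip-colour I avoids (mv v A p) = refl

    rigid⇒no-flips : ∀ I → Rigid E I → (∀ w → flips w ≡ true → I w ≡ false) → ∀ w → flips w ≡ false
    rigid⇒no-flips I rigid avoids w =
      not-injective (end-injective (rigid flip flip-bijective flip-adjacent (flip-colour I avoids) (a w)))

  module Colouring (I : Fin m → Bool) (χ : Vtx E → ℕ) (equitable : Equitable E I χ)
                   (S : Vtx E → Bool) (component : ColorComponent E χ S) where

    same-part : ∀ {x y} → χ x ≡ χ y → part x ≡ part y
    same-part {x} {y} χxy =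
      trans (sym (part-cI I x)) (trans (cong colour-part (proj₁ equitable x y χxy)) (part-cI I y))

    neighbour-transfer : ∀ {p q z} → χ p ≡ χ q → adjR p z ≡ true →
                         ∃ λ z' → adjR q z' ≡ true × χ z' ≡ χ z
    neighbour-transfer {p} {q} {z} χpq p-sees-z =
      let z' , hit = count-transfer (allVtx-complete z) sees-z
                       (proj₂ equitable (χ p) (χ z) p q refl (sym χpq))
          q-sees-z' , colour = ∧-elim hit
      in z' , q-sees-z' , ≡ᵇ⇒≡ (χ z') (χ z) (from T-≡ colour)
      where
      sees-z : adjR p z ∧ (χ z ≡ᵇ χ z) ≡ true
      sees-z = cong₂ _∧_ p-sees-z (to T-≡ (≡⇒≡ᵇ (χ z) (χ z) refl))

    -- Two χ-equivalent vertices cannot be joined to a χ-class in opposite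
    -- uniform ways: the one seeing the class forces the other to see it.
    no-opposite-uniform : ∀ {d d' z₀ j c} → χ d ≡ χ d' → χ z₀ ≡ j →
                          (∀ z → χ z ≡ j → adjR d z ≡ c) → (∀ z → χ z ≡ j → adjR d' z ≡ not c) → ⊥
    no-opposite-uniform {c = true} χdd' χz₀ d-sees d'-blind = one-sided χdd' χz₀ d-sees d'-blind
      where
      one-sided : ∀ {d d' z₀ j} → χ d ≡ χ d' → χ z₀ ≡ j →
                  (∀ z → χ z ≡ j → adjR d z ≡ true) → (∀ z → χ z ≡ j → adjR d' z ≡ false) → ⊥
      one-sided {z₀ = z₀} χdd' χz₀ sees blind =
        let z' , d'-sees-z' , χz' = neighbour-transfer χdd' (sees z₀ χz₀)
        in true≢false (trans (sym d'-sees-z') (blind z' (trans χz' χz₀)))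
    no-opposite-uniform {c = false} χdd' χz₀ d-blind d'-sees =
      no-opposite-uniform {c = true} (sym χdd') χz₀ d'-sees d-blind

    uniform-across : ∀ {u x y} → χ x ≡ χ y → S x ≡ S y → S u ≢ S x → adjR u x ≡ adjR u y
    uniform-across {u} {x} {y} χxy Sxy u≢x with S u ≟ true
    ... | yes u∈S =
      joined-constant (component (χ u) (χ x)) (u∈S , refl) (u∈S , refl)
        (refl , x∉S) (sym χxy , trans (sym Sxy) x∉S)
      where
      x∉S : S x ≡ false
      x∉S = ¬-not (λ x∈S → u≢x (trans u∈S (sym x∈S)))
    ... | no u∉S =
      trans (adj-sym u x) (trans across (adj-sym y u))
      where
      x∈S : S x ≡ true
      x∈S = ¬-not (λ x∉S → u≢x (trans (¬-not u∉S) (sym x∉S)))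
      across : adjR x u ≡ adjR y u
      across = joined-constant (component (χ x) (χ u)) (x∈S , refl) (trans (sym Sxy) x∈S , sym χxy)
                 (refl , ¬-not u∉S) (refl , ¬-not u∉S)

    -- d, d' are χ-equivalent, separated by S, and see the χ-class j in
    -- complementary ways (as the two ends of a wire see a block M(v)).
    record Opposed (d d' : Vtx E) (j : ℕ) : Set where
      field
        same-colour   : χ d ≡ χ d'
        separated     : S d ≢ S d'
        complementary : ∀ z → χ z ≡ j → adjR d' z ≡ not (adjR d z)
    open Opposed

    opposed-sym : ∀ {d d' j} → Opposed d d' j → Opposed d' d j
    opposed-sym o = record
      { same-colour = sym (same-colour o)
      ; separated = separated o ∘ sym
      ; complementary = λ z χz → trans (sym (not-involutive _)) (cong not (sym (complementary o z χz)))
      }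

    opposed-uniform : ∀ {d d' j x y} → Opposed d d' j → χ x ≡ j → χ y ≡ j → S x ≡ S y →
                      adjR d x ≡ adjR d y
    opposed-uniform {d} {d'} {x = x} {y} o χx χy Sxy with one-differs (separated o) (S x)
    ... | inj₁ d≢x = uniform-across (trans χx (sym χy)) Sxy d≢x
    ... | inj₂ d'≢x = not-injective (begin
      not (adjR d x) ≡⟨ sym (complementary o x χx) ⟩
      adjR d' x      ≡⟨ uniform-across (trans χx (sym χy)) Sxy d'≢x ⟩
      adjR d' y      ≡⟨ complementary o y χy ⟩
      not (adjR d y) ∎)
      where open ≡-Reasoning

    opposed-distinguishes : ∀ {d d' j x y} → Opposed d d' j → χ x ≡ j → χ y ≡ j → S x ≢ S y →
                            adjR d x ≢ adjR d y
    opposed-distinguishes {d} {d'} {j} {x} {y} o χx χy Sx≢Sy dx≡dy =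
      no-opposite-uniform (same-colour o) χx d-uniform d'-uniform
      where
      d-uniform : ∀ z → χ z ≡ j → adjR d z ≡ adjR d x
      d-uniform z χz with bool-dichotomy Sx≢Sy (S z)
      ... | inj₁ z~x = opposed-uniform o χz χx z~x
      ... | inj₂ z~y = trans (opposed-uniform o χz χy z~y) (sym dx≡dy)
      d'-uniform : ∀ z → χ z ≡ j → adjR d' z ≡ not (adjR d x)
      d'-uniform z χz = trans (complementary o z χz) (cong not (d-uniform z χz))

    opposed-split-from : ∀ {d d' j x} → Opposed d d' j → χ x ≡ j → adjR d x ≡ true →
                         ∃ λ y → χ y ≡ j × S y ≢ S x
    opposed-split-from {d} {d'} {x = x} o χx d-sees-x =
      let z , d'-sees-z , χzx = neighbour-transfer (same-colour o) d-sees-x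
          χz = trans χzx χx
      in z , χz , λ z~x → true≢false (begin
           true           ≡⟨ sym d'-sees-z ⟩
           adjR d' z      ≡⟨ complementary o z χz ⟩
           not (adjR d z) ≡⟨ cong not (opposed-uniform o χz χx z~x) ⟩
           not (adjR d x) ≡⟨ cong not d-sees-x ⟩
           false          ∎)
      where open ≡-Reasoning

    opposed-splits : ∀ {d d' j x} → Opposed d d' j → χ x ≡ j → ∃ λ y → χ y ≡ j × S y ≢ S x
    opposed-splits {d} {x = x} o χx with adjR d x ≟ true
    ... | yes d-sees-x = opposed-split-from o χx d-sees-x
    ... | no d-misses-x =
      opposed-split-from (opposed-sym o) χx (trans (complementary o x χx) (cong not (¬-not d-misses-x)))

    Twisted : Fin m → Set
    Twisted w = χ (a w) ≡ χ (b w) × S (a w) ≢ S (b w)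

    twisted? : ∀ w → Dec (Twisted w)
    twisted? w = (χ (a w) ≟ℕ χ (b w)) ×-dec ¬? (S (a w) ≟ S (b w))

    twisted : Fin m → Bool
    twisted w = does (twisted? w)

    twisted-sound : ∀ w → twisted w ≡ true → Twisted w
    twisted-sound w = sound (twisted? w)
      where
      sound : (d : Dec (Twisted w)) → does d ≡ true → Twisted w
      sound (yes tw) _ = tw
      sound (no _) ()

    wire-opposed : ∀ {v w x} → E v w ≡ true → Twisted w → part x ≡ inj₂ v → Opposed (a w) (b w) (χ x)
    wire-opposed w∈N (χab , Sab) x∈M = record
      { same-colour = χab
      ; separated = Sab
      ; complementary = λ z χzx → ends-complementary w∈N (M-view (trans (same-part χzx) x∈M))
      }

    lonely-end : ∀ {w z} → χ (a w) ≢ χ (b w) → χ z ≡ χ (a w) → z ≡ a w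
    lonely-end apart χz with wire-view (same-part χz)
    ... | inj₁ z≡a = z≡a
    ... | inj₂ refl = ⊥-elim (apart (sym χz))

    apart-end-kept : ∀ {w x y} → χ (a w) ≢ χ (b w) → χ x ≡ χ y → adjR x (a w) ≡ adjR y (a w)
    apart-end-kept {w} {x} {y} apart χxy with adjR x (a w) ≟ adjR y (a w)
    ... | yes same = same
    ... | no differ = ⊥-elim (no-opposite-uniform χxy refl
          (λ z χz → cong (adjR x) (lonely-end apart χz))
          (λ z χz → trans (cong (adjR y) (lonely-end apart χz)) (¬-not (differ ∘ sym))))

    -- A vertex of M(v) on the other side of S from the χ-equivalent ends of
    -- some w ∈ N(v) would see both ends alike, contradicting complementarity.
    ends-alike-impossible : ∀ {v w u} → E v w ≡ true → χ (a w) ≡ χ (b w) → S (a w) ≡ S (b w) →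
                            InM v u → S u ≢ S (a w) → ⊥
    ends-alike-impossible {w = w} {u} w∈N χab Sab u∈M u≢a = not-¬ refl (begin
      adjR (a w) u       ≡⟨ adj-sym (a w) u ⟩
      adjR u (a w)       ≡⟨ uniform-across χab Sab u≢a ⟩
      adjR u (b w)       ≡⟨ adj-sym u (b w) ⟩
      adjR (b w) u       ≡⟨ ends-complementary w∈N u∈M ⟩
      not (adjR (a w) u) ∎)
      where open ≡-Reasoning

    twisted-differ : ∀ {v w A B} .{p : T (good E v A)} .{q : T (good E v B)} →
                     Twisted w → E v w ≡ true → χ (mv v A p) ≡ χ (mv v B q) →
                     S (mv v A p) ≢ S (mv v B q) → lookup A w ≢ lookup B w
    twisted-differ {v} {A = A} {p = p} tw w∈N χAB SAB =
      opposed-distinguishes (wire-opposed {x = mv v A p} w∈N tw refl) refl (sym χAB) SAB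

    untwisted-agree : ∀ {v w A B} .{p : T (good E v A)} .{q : T (good E v B)} →
                      ¬ Twisted w → E v w ≡ true → χ (mv v A p) ≡ χ (mv v B q) →
                      S (mv v A p) ≢ S (mv v B q) → lookup A w ≡ lookup B w
    untwisted-agree {w = w} {A} {B} {p} {q} ¬tw w∈N χAB SAB with χ (a w) ≟ℕ χ (b w)
    ... | no apart = apart-end-kept apart χAB
    ... | yes χab with S (a w) ≟ S (b w)
    ...   | no Sa≢Sb = ⊥-elim (¬tw (χab , Sa≢Sb))
    ...   | yes Sab with one-differs SAB (S (a w))
    ...     | inj₁ A≢a = ⊥-elim (ends-alike-impossible w∈N χab Sab (m-vertex A p) A≢a)
    ...     | inj₂ B≢a = ⊥-elim (ends-alike-impossible w∈N χab Sab (m-vertex B q) B≢a)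

    twisted-at-split : ∀ {v A B} .{p : T (good E v A)} .{q : T (good E v B)} →
                       χ (mv v A p) ≡ χ (mv v B q) → S (mv v A p) ≢ S (mv v B q) →
                       wiresAt twisted v ≡ zipWith _xor_ A B
    twisted-at-split {v} {A} {B} {p} {q} χAB SAB = vec-ext λ w →
      trans (lookup∘tabulate _ w) (trans (membership w) (sym (lookup-zipWith _xor_ w A B)))
      where
      by-decision : ∀ {w} → E v w ≡ true → (d : Dec (Twisted w)) → does d ≡ lookup A w xor lookup B w
      by-decision w∈N (yes tw) = sym (xor-≢ (twisted-differ tw w∈N χAB SAB))
      by-decision w∈N (no ¬tw) = sym (xor-≡ (untwisted-agree ¬tw w∈N χAB SAB))

      membership : ∀ w → twisted w ∧ E v w ≡ lookup A w xor lookup B w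
      membership w with E v w in w∈N
      ... | true = trans (∧-identityʳ (twisted w)) (by-decision w∈N (twisted? w))
      ... | false = trans (∧-zeroʳ (twisted w))
                      (sym (xor-≡ (trans (outside-nbh {v} {A} p w∈N) (sym (outside-nbh {v} {B} q w∈N)))))

    -- Every vertex v has an even number of twisted neighbours: if there is
    -- one, its ends split the χ-class of m_∅(v), and A ⊕ B is even.
    twisted-balanced : ∀ v → evenᵇ (card (wiresAt twisted v)) ≡ true
    twisted-balanced v with empty-or-member (wiresAt twisted v)
    ... | inj₁ none = trans (cong (evenᵇ ∘ card) none) (cong evenᵇ (card-empty m))
    ... | inj₂ (w , member) =
      let tw , w∈N = ∧-elim (trans (sym (lookup∘tabulate (λ w → twisted w ∧ E v w) w)) member)
          y , χy , Sy = opposed-splits (wire-opposed {x = m∅} w∈N (twisted-sound w tw) refl) refl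
      in even-from-split (M-view (same-part χy)) χy Sy
      where
      m∅ : Vtx E
      m∅ = mv v (replicate m false) (empty-index {v})

      even-from-split : ∀ {y} → InM v y → χ y ≡ χ m∅ → S y ≢ S m∅ →
                        evenᵇ (card (wiresAt twisted v)) ≡ true
      even-from-split (m-vertex B q) χy Sy =
        trans (cong (evenᵇ ∘ card) (twisted-at-split (sym χy) (Sy ∘ sym)))
              (even-xor-closed {A = replicate m false} {B}
                 (proj₂ (index-good {v} {replicate m false} (empty-index {v})))
                 (proj₂ (index-good {v} {B} q)))

    -- Twisted wires avoid I, since their ends share a colour of R^I(G).
    twisted-avoid-I : ∀ w → twisted w ≡ true → I w ≡ false
    twisted-avoid-I w tw =
      equal-end-colours {I} (proj₁ equitable (a w) (b w) (proj₁ (twisted-sound w tw)))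

    -- Rigidity: flipping the twisted wires is trivial, so there are none.
    never-twisted : Rigid E I → ∀ w → ¬ Twisted w
    never-twisted rigid w tw =
      true≢false (trans (sym (dec-true (twisted? w) tw))
                        (Flip.rigid⇒no-flips twisted twisted-balanced I rigid twisted-avoid-I w))

    -- Under rigidity S separates no two χ-equivalent vertices: a split pair
    -- would be the two ends of a twisted wire, or m_A(v), m_B(v) with A = B.
    no-split : Rigid E I → ∀ x y → χ x ≡ χ y → S x ≢ S y → ⊥
    no-split rigid (a w) y χxy Sxy with wire-view (sym (same-part χxy))
    ... | inj₁ refl = Sxy refl
    ... | inj₂ refl = never-twisted rigid w (χxy , Sxy)
    no-split rigid (b w) y χxy Sxy with wire-view (sym (same-part χxy))
    ... | inj₁ refl = never-twisted rigid w (sym χxy , Sxy ∘ sym)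
    ... | inj₂ refl = Sxy refl
    no-split rigid (mv v A p) y χxy Sxy with M-view (sym (same-part χxy))
    ... | m-vertex B q = Sxy (cong S (mv-cong (vec-ext same-index)))
      where
      same-index : ∀ w → lookup A w ≡ lookup B w
      same-index w with E v w in w∈N
      ... | true = untwisted-agree (never-twisted rigid w) w∈N χxy Sxy
      ... | false = trans (outside-nbh {v} {A} p w∈N) (sym (outside-nbh {v} {B} q w∈N))

    S-constant-on-classes : Rigid E I → ∀ x y → χ x ≡ χ y → S x ≡ S y
    S-constant-on-classes rigid x y χxy = decidable-stable (S x ≟ S y) (no-split rigid x y χxy)

corollary2 : (n m : ℕ) (E : Fin n → Fin m → Bool) (I : Fin m → Bool) →
    Rigid E I →
    (χ : Vtx E → ℕ) → Equitable E I χ →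
    (S : Vtx E → Bool) → ColorComponent E χ S → UnionOfClasses E χ S
corollary2 n m E I rigid χ equitable S component x y χxy x∈S =
  trans (sym (S-constant-on-classes rigid x y χxy)) x∈S
  where open Multipede.Colouring E I χ equitable S component
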